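{- Run Algorithm PMR (defined in the context) with parameters $\gamma\ge1$, $0<R^*<1/2$, let $n\ell=|V_R|$, and suppose $R>R^*$ (so the remaining cluster $V_B$ is handled by Random Partitioning). Then $ALG_R\ge\frac23(1-\ell)\,n\,(W-W_R)$.
   Context: Instance: a finite set $V$ of $n$ vertices of $G=(V,E)$ with nonnegative dissimilarity weights $w_{i,j}=w_{j,i}$; $W=\sum_{(i,j)\in E}w_{i,j}$. For a hierarchical clustering tree $T$ (rooted tree with leaf set $V$), $T_{i,j}$ is the subtree rooted at the least common ancestor of $i,j$ and $|T_{i,j}|$ its number of leaves. Random Partitioning: recursively split every cluster with at least two vertices into two nonempty parts uniformly at random (each vertex independently and uniformly on one of two sides, repeating if a side is empty). Algorithm PMR: set $V_B\leftarrow V$, $E_B\leftarrow E$. While some $v\in V_B$ has $W_v=\sum_{u\in V_B,(v,u)\in E_B}w_{v,u}\ge\gamma\frac{2W}{n}$ (original $W,n$), choose $v^*$ with largest $W_v$, split the current cluster $V_B$ into $\{v^*\}$ and $V_B\setminus\{v^*\}$, delete $v^*$ from $V_B$ and its incident edges from $E_B$. Deleted vertices form $V_R$; red edges (with an endpoint in $V_R$) have total weight $W_R$; $R=W_R/W$. If $R>R^*$, run Random Partitioning on $V_B$; otherwise split $V_B$ by a Goemans–Williamson max cut of $(V_B,E_B)$ and run Random Partitioning on both sides. With $T$ the output tree, $ALG_R$ is the expected value (over Random Partitioning) of $\sum_{(i,j)\in E_B}w_{i,j}|T_{i,j}|$, where $E_B$ is the edge set remaining after the peel-off phase.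
   Formalization: The dissimilarity weights $w_{i,j}$ and the parameters γ and $R^*$ are rational. -}

module Defs where

open import Data.Bool using (Bool; true; false; _∧_; _∨_; not; if_then_else_)
open import Data.Nat as ℕ using (ℕ; zero; suc; NonZero)
open import Data.Integer using (+_)
open import Data.Fin using (Fin; toℕ)
open import Data.Fin.Properties using (_≟_)
open import Data.List using (List; []; _∷_; map; concatMap; filter; length; foldr; _++_; allFin; null)
open import Data.Product using (_×_; _,_; proj₁; proj₂; Σ)
open import Data.Rational using (ℚ; 0ℚ; 1ℚ; _+_; _*_; _/_; _≤_; _<_)
open import Relation.Nullary.Decidable using (⌊_⌋)
open import Data.Unit using (⊤)
open import Data.Empty using (⊥)

ℕ→ℚ : ℕ → ℚ
ℕ→ℚ k = + k / 1

sumℚ : List ℚ → ℚ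
sumℚ = foldr _+_ 0ℚ

T : Bool → Set
T true  = ⊤
T false = ⊥

-- Edge set convention: every unordered pair {i,j}, i ≠ j, is a potential
-- edge; non-edges carry weight 0 (so they contribute nothing anywhere).

VSet : ℕ → Set
VSet n = Fin n → Bool

pairs : (n : ℕ) → List (Fin n × Fin n)
pairs n = concatMap (λ i → map (λ j → (i , j)) (filter (λ j → ℕ._<?_ (toℕ i) (toℕ j)) (allFin n))) (allFin n)

totalW : {n : ℕ} → (Fin n → Fin n → ℚ) → ℚ
totalW {n} w = sumℚ (map (λ p → w (proj₁ p) (proj₂ p)) (pairs n))

weightIn : {n : ℕ} → (Fin n → Fin n → ℚ) → VSet n → ℚ
weightIn {n} w B = sumℚ (map (λ p → w (proj₁ p) (proj₂ p))
                    (filter (λ p → Data.Bool.T? (B (proj₁ p) ∧ B (proj₂ p))) (pairs n)))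
  where import Data.Bool

redWeight : {n : ℕ} → (Fin n → Fin n → ℚ) → VSet n → ℚ
redWeight {n} w B = sumℚ (map (λ p → w (proj₁ p) (proj₂ p))
                    (filter (λ p → Data.Bool.T? (not (B (proj₁ p) ∧ B (proj₂ p)))) (pairs n)))
  where import Data.Bool

degIn : {n : ℕ} → (Fin n → Fin n → ℚ) → VSet n → Fin n → ℚ
degIn {n} w B v = sumℚ (map (λ u → w v u)
                    (filter (λ u → Data.Bool.T? (B u ∧ not ⌊ u ≟ v ⌋)) (allFin n)))
  where import Data.Bool

remove : {n : ℕ} → Fin n → VSet n → VSet n
remove v B u = if ⌊ u ≟ v ⌋ then false else B u

-- ValidPeel w thr B vs : starting from current cluster B, the list vs is
-- the sequence of vertices removed by the peel-off loop with threshold thr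
-- (= γ·2W/n), each chosen with maximum W_v (any tie-break), and the loop
-- stops exactly when no vertex of the final cluster reaches thr.

ValidPeel : {n : ℕ} → (Fin n → Fin n → ℚ) → ℚ → VSet n → List (Fin n) → Set
ValidPeel {n} w thr B [] = (v : Fin n) → T (B v) → degIn w B v < thr
ValidPeel {n} w thr B (v ∷ vs) =
  T (B v) × thr ≤ degIn w B v
  × ((u : Fin n) → T (B u) → degIn w B u ≤ degIn w B v)
  × ValidPeel w thr (remove v B) vs

remaining : {n : ℕ} → List (Fin n) → VSet n
remaining []       = λ _ → true
remaining (v ∷ vs) = remove v (remaining vs)

data Tree (n : ℕ) : Set where
  leaf : Fin n → Tree n
  node : Tree n → Tree n → Tree n

leaves : {n : ℕ} → Tree n → ℕ
leaves (leaf _)   = 1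
leaves (node l r) = leaves l ℕ.+ leaves r

mem : {n : ℕ} → Fin n → Tree n → Bool
mem i (leaf v)   = ⌊ i ≟ v ⌋
mem i (node l r) = mem i l ∨ mem i r

lcaSize : {n : ℕ} → Tree n → Fin n → Fin n → ℕ
lcaSize (leaf _) i j = 1
lcaSize (node l r) i j =
  if mem i l ∧ mem j l then lcaSize l i j
  else if mem i r ∧ mem j r then lcaSize r i j
  else leaves (node l r)

splits : {A : Set} → List A → List (List A × List A)
splits []       = ([] , []) ∷ []
splits (x ∷ xs) = map (λ p → (x ∷ proj₁ p , proj₂ p)) (splits xs)
               ++ map (λ p → (proj₁ p , x ∷ proj₂ p)) (splits xs)

-- colourings with both sides nonempty (the "repeat if a side is empty"
-- rejection sampling yields the uniform distribution on these)
properSplits : {A : Set} → List A → List (List A × List A)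
properSplits xs = filter (λ p → Data.Bool.T? (not (null (proj₁ p)) ∧ not (null (proj₂ p)))) (splits xs)
  where import Data.Bool

-- uniform probability 1/k on a list of length k (k ≥ 1 whenever used)
unif : ℕ → ℚ
unif zero    = 0ℚ
unif (suc k) = + 1 / suc k

-- rp fuel S : list of (probability, tree) pairs = distribution of the
-- tree produced by Random Partitioning on cluster S (fuel = |S| suffices).
rp : {n : ℕ} → ℕ → List (Fin n) → List (ℚ × Tree n)
rp _       []          = []
rp _       (v ∷ [])    = (1ℚ , leaf v) ∷ []
rp zero    (_ ∷ _ ∷ _) = []
rp (suc f) S@(_ ∷ _ ∷ _) =
  concatMap (λ ab →
    concatMap (λ pt →
      map (λ qt → (unif (length (properSplits S)) * proj₁ pt * proj₁ qt ,
                   node (proj₂ pt) (proj₂ qt)))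
          (rp f (proj₂ ab)))
      (rp f (proj₁ ab)))
    (properSplits S)

randomPartitioning : {n : ℕ} → List (Fin n) → List (ℚ × Tree n)
randomPartitioning S = rp (length S) S

members : {n : ℕ} → VSet n → List (Fin n)
members {n} B = filter (λ v → Data.Bool.T? (B v)) (allFin n)
  where import Data.Bool

-- Output tree of PMR when R > R*: peeled vertices split off one at a time
-- (first peeled vertex at the root), then Random Partitioning on V_B.

pmrTree : {n : ℕ} → List (Fin n) → Tree n → Tree n
pmrTree []       TB = TB
pmrTree (v ∷ vs) TB = node (leaf v) (pmrTree vs TB)

costB : {n : ℕ} → (Fin n → Fin n → ℚ) → VSet n → Tree n → ℚ
costB {n} w B t = sumℚ (map (λ p → w (proj₁ p) (proj₂ p) * ℕ→ℚ (lcaSize t (proj₁ p) (proj₂ p)))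
                    (filter (λ p → Data.Bool.T? (B (proj₁ p) ∧ B (proj₂ p))) (pairs n)))
  where import Data.Bool

ALG-R : {n : ℕ} → (Fin n → Fin n → ℚ) → List (Fin n) → ℚ
ALG-R w vs = sumℚ (map (λ pt → proj₁ pt * costB w VB (pmrTree vs (proj₂ pt)))
                       (randomPartitioning (members VB)))
  where VB = remaining vs

module Submission where

-- For an edge {i, j} of E_B both endpoints survive the peel-off phase, and the
-- peeled vertices are split off as leaves above the Random Partitioning tree of
-- V_B, so |T_ij| is its lca size in that tree.  For a cluster S ∋ i, j the
-- expected lca size is at least (2/3)|S|, by induction: if the first split
-- (A, B) keeps i and j on one side, the conditional expectation is at least
-- (2/3)|A| (resp. (2/3)|B|), and otherwise it is |S|.  To average these bounds
-- over the splits, sum them (tripled) over all 2-colourings of S, a sum that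
-- does not depend on the order of S, and group, for each colouring of the other
-- vertices, the four placements of i and j: with a + b + 2 = m they contribute
-- 2(a + 2) + 3m + 3m + 2(b + 2) ≥ 4·2m.  The two improper colourings contribute
-- exactly 2m each, so the average over proper splits is at least 2m as well.
-- Summing over E_B, of weight W − W_R, with |V_B| ≥ n − |V_R| = (1 − ℓ)n gives
-- the theorem.

open import Defs
open import Data.Nat using (ℕ; NonZero)
open import Data.Integer using (+_)
open import Data.Fin using (Fin)
open import Data.Bool using (true)
open import Data.List using (List; length)
open import Data.Rational using (ℚ; 0ℚ; 1ℚ; _+_; _-_; _*_; _/_; _≤_; _<_)
open import Relation.Binary.PropositionalEquality using (_≡_)

open import Algebra.Bundles using (CommutativeMonoid)
open import Data.Bool using (Bool; false; not; _∧_; _∨_; if_then_else_; T?)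
import Data.Bool.Base as 𝔹
open import Data.Bool.Properties
  using (∨-assoc; ∨-zeroʳ; ∨-identityʳ; ∨-conicalˡ; ∨-conicalʳ; ∧-zeroʳ; ∧-conicalˡ; ∧-conicalʳ; ∨-commutativeMonoid)
open import Algebra.Properties.CommutativeSemigroup (CommutativeMonoid.commutativeSemigroup ∨-commutativeMonoid)
  using () renaming (x∙yz≈y∙xz to ∨-middle)
open import Data.Empty using (⊥-elim)
open import Data.Fin using (toℕ)
open import Data.Fin.Properties using (_≟_)
import Data.Integer as ℤ
import Data.Integer.Properties as ℤ
open import Data.List using ([]; _∷_; [_]; _++_; map; concatMap; filter; foldr; null; allFin)
open import Data.List.Properties using (length-tabulate; filter-all)
open import Data.List.Membership.Propositional using (_∈_)
open import Data.List.Membership.Propositional.Properties using (∈-map⁺; ∈-++⁺ˡ; ∈-++⁺ʳ; ∈-filter⁺; ∈-allFin)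
open import Data.List.Relation.Binary.Permutation.Propositional as ↭ using (_↭_)
open import Data.List.Relation.Binary.Permutation.Propositional.Properties using (↭-length)
open import Data.List.Relation.Unary.All as All using (All; []; _∷_)
open import Data.List.Relation.Unary.All.Properties using (map⁺; ++⁺; concat⁺; filter⁺; all-filter)
import Data.List.Relation.Unary.AllPairs as AllPairs
open import Data.List.Relation.Unary.Any using (here; there)
open import Data.List.Relation.Unary.Unique.Propositional using (Unique)
import Data.List.Relation.Unary.Unique.Propositional.Properties as Unique
open import Data.Nat using (zero; suc)
import Data.Nat as ℕ
import Data.Nat.Properties as ℕ
open import Data.Nat.Tactic.RingSolver using (solve-∀)
open import Data.Product using (_×_; _,_; proj₁; proj₂; ∃; uncurry)
open import Data.Rational using (-_; toℚᵘ; NonNegative; nonNegative)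
open import Data.Rational.Properties
  using ( module ≤-Reasoning; toℚᵘ-injective; toℚᵘ-fromℚᵘ; toℚᵘ-homo-+; toℚᵘ-homo-*
        ; normalize-nonNeg; nonNegative⁻¹; ≤-refl; ≤-trans; ≤-reflexive; +-mono-≤; +-monoˡ-≤; +-monoʳ-≤
        ; +-identityʳ; *-comm; *-assoc; *-identityˡ; *-identityʳ; *-zeroˡ; *-zeroʳ; *-distribˡ-+
        ; *-monoˡ-≤-nonNeg; *-monoʳ-≤-nonNeg )
  renaming (+-0-commutativeMonoid to ℚ-+-commutativeMonoid)
open import Data.Rational.Solver using (module +-*-Solver)
open +-*-Solver using (solve; _:+_; _:-_; _:*_; _:=_; con)
import Data.Rational.Unnormalised as ℚᵘ
import Data.Rational.Unnormalised.Properties as ℚᵘ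
open import Function using (_∘_; id)
open import Level using (0ℓ)
open import Relation.Binary.PropositionalEquality
  using (_≢_; refl; sym; trans; cong; cong₂; subst; module ≡-Reasoning)
open import Relation.Nullary.Decidable using (⌊_⌋; yes; no)

private
  toℚᵘ-ℕ→ℚ : ∀ k → toℚᵘ (ℕ→ℚ k) ℚᵘ.≃ ℚᵘ.mkℚᵘ (+ k) 0
  toℚᵘ-ℕ→ℚ k = toℚᵘ-fromℚᵘ (ℚᵘ.mkℚᵘ (+ k) 0)

ℕ→ℚ-+ : ∀ a b → ℕ→ℚ (a ℕ.+ b) ≡ ℕ→ℚ a + ℕ→ℚ b
ℕ→ℚ-+ a b = toℚᵘ-injective (ℚᵘ.≃-trans (toℚᵘ-ℕ→ℚ (a ℕ.+ b)) (ℚᵘ.≃-sym (ℚᵘ.≃-trans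
  (toℚᵘ-homo-+ (ℕ→ℚ a) (ℕ→ℚ b))
  (ℚᵘ.≃-trans (ℚᵘ.+-cong (toℚᵘ-ℕ→ℚ a) (toℚᵘ-ℕ→ℚ b))
              (ℚᵘ.*≡* (cong (ℤ._* + 1) (trans (cong₂ ℤ._+_ (ℤ.*-identityʳ (+ a)) (ℤ.*-identityʳ (+ b)))
                                               (sym (ℤ.pos-+ a b)))))))))

ℕ→ℚ-* : ∀ a b → ℕ→ℚ (a ℕ.* b) ≡ ℕ→ℚ a * ℕ→ℚ b
ℕ→ℚ-* a b = toℚᵘ-injective (ℚᵘ.≃-trans (toℚᵘ-ℕ→ℚ (a ℕ.* b)) (ℚᵘ.≃-sym (ℚᵘ.≃-trans
  (toℚᵘ-homo-* (ℕ→ℚ a) (ℕ→ℚ b))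
  (ℚᵘ.≃-trans (ℚᵘ.*-cong (toℚᵘ-ℕ→ℚ a) (toℚᵘ-ℕ→ℚ b))
              (ℚᵘ.*≡* (cong (ℤ._* + 1) (sym (ℤ.pos-* a b))))))))

ℕ→ℚ-*-inverse : ∀ k → ℕ→ℚ (suc k) * (+ 1 / suc k) ≡ 1ℚ
ℕ→ℚ-*-inverse k = toℚᵘ-injective (ℚᵘ.≃-trans (toℚᵘ-homo-* (ℕ→ℚ (suc k)) (+ 1 / suc k))
  (ℚᵘ.≃-trans (ℚᵘ.*-cong (toℚᵘ-ℕ→ℚ (suc k)) (toℚᵘ-fromℚᵘ (ℚᵘ.mkℚᵘ (+ 1) k)))
              (ℚᵘ.*≡* (cong (λ m → + suc m) (identity k)))))
  where
  -- ℚᵘ's cross-multiplication compares + suc (k * 1 * 1) with + suc (k + 0 + 0)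
  identity : ∀ k → k ℕ.* 1 ℕ.* 1 ≡ k ℕ.+ 0 ℕ.+ 0
  identity = solve-∀

ℕ→ℚ-nonNeg : ∀ k → 0ℚ ≤ ℕ→ℚ k
ℕ→ℚ-nonNeg k = nonNegative⁻¹ (ℕ→ℚ k) {{normalize-nonNeg k 1}}

ℕ→ℚ-mono : ∀ {a b} → a ℕ.≤ b → ℕ→ℚ a ≤ ℕ→ℚ b
ℕ→ℚ-mono {a} a≤b with ℕ.m≤n⇒∃[o]m+o≡n a≤b
... | o , refl = subst (_≤ ℕ→ℚ (a ℕ.+ o)) (+-identityʳ (ℕ→ℚ a))
                       (subst (ℕ→ℚ a + 0ℚ ≤_) (sym (ℕ→ℚ-+ a o)) (+-monoʳ-≤ (ℕ→ℚ a) (ℕ→ℚ-nonNeg o)))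

ℕ→ℚ-sub-≤ : ∀ {a b c} → a ℕ.≤ b ℕ.+ c → ℕ→ℚ a - ℕ→ℚ c ≤ ℕ→ℚ b
ℕ→ℚ-sub-≤ {a} {b} {c} a≤b+c =
  ≤-trans (+-monoˡ-≤ (- ℕ→ℚ c) (subst (ℕ→ℚ a ≤_) (ℕ→ℚ-+ b c) (ℕ→ℚ-mono a≤b+c)))
          (≤-reflexive (solve 2 (λ b c → (b :+ c) :- c := b) refl (ℕ→ℚ b) (ℕ→ℚ c)))

one-minus-fraction : ∀ k c l x y →
  c * (1ℚ - l * (+ 1 / suc k)) * ℕ→ℚ (suc k) * ((x + y) - y) ≡ c * (ℕ→ℚ (suc k) - l) * x
one-minus-fraction k c l x y = begin
  c * (1ℚ - l * (+ 1 / suc k)) * N * ((x + y) - y)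
    ≡⟨ solve 6 (λ c l r N x y → c :* (con 1ℚ :- l :* r) :* N :* ((x :+ y) :- y) := c :* (N :- l :* (r :* N)) :* x)
               refl c l (+ 1 / suc k) N x y ⟩
  c * (N - l * (+ 1 / suc k * N)) * x
    ≡⟨ cong (λ q → c * (N - l * q) * x) (trans (*-comm (+ 1 / suc k) N) (ℕ→ℚ-*-inverse k)) ⟩
  c * (N - l * 1ℚ) * x
    ≡⟨ cong (λ q → c * (N - q) * x) (*-identityʳ l) ⟩
  c * (N - l) * x
    ∎
  where
  open ≡-Reasoning
  N = ℕ→ℚ (suc k)

-- These rely on + 1 / 3 * ℕ→ℚ 2 and + 1 / 3 * ℕ→ℚ 3 computing to + 2 / 3 and 1ℚ.
⅓-ℕ→ℚ-2* : ∀ a → + 1 / 3 * ℕ→ℚ (2 ℕ.* a) ≡ + 2 / 3 * ℕ→ℚ a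
⅓-ℕ→ℚ-2* a = trans (cong (+ 1 / 3 *_) (ℕ→ℚ-* 2 a)) (sym (*-assoc (+ 1 / 3) (ℕ→ℚ 2) (ℕ→ℚ a)))

⅓-ℕ→ℚ-3* : ∀ a → + 1 / 3 * ℕ→ℚ (3 ℕ.* a) ≡ ℕ→ℚ a
⅓-ℕ→ℚ-3* a = trans (cong (+ 1 / 3 *_) (ℕ→ℚ-* 3 a))
                    (trans (sym (*-assoc (+ 1 / 3) (ℕ→ℚ 3) (ℕ→ℚ a))) (*-identityˡ (ℕ→ℚ a)))

module ListSum (M : CommutativeMonoid 0ℓ 0ℓ) where
  open CommutativeMonoid M renaming (Carrier to R; refl to ≈-refl; sym to ≈-sym; trans to ≈-trans)
  open import Algebra.Properties.CommutativeSemigroup commutativeSemigroup using (interchange; x∙yz≈y∙xz)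
  open import Relation.Binary.Reasoning.Setoid setoid

  sumOf : {A : Set} → (A → R) → List A → R
  sumOf f xs = foldr _∙_ ε (map f xs)

  module _ {A : Set} where

    sumOf-++ : (f : A → R) (xs ys : List A) → sumOf f (xs ++ ys) ≈ sumOf f xs ∙ sumOf f ys
    sumOf-++ f []       ys = ≈-sym (identityˡ _)
    sumOf-++ f (x ∷ xs) ys = begin
      f x ∙ sumOf f (xs ++ ys)         ≈⟨ ∙-congˡ (sumOf-++ f xs ys) ⟩
      f x ∙ (sumOf f xs ∙ sumOf f ys)  ≈⟨ assoc _ _ _ ⟨
      (f x ∙ sumOf f xs) ∙ sumOf f ys  ∎

    sumOf-congᴬ : {f g : A → R} {xs : List A} → All (λ x → f x ≈ g x) xs → sumOf f xs ≈ sumOf g xs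
    sumOf-congᴬ []         = ≈-refl
    sumOf-congᴬ (fx≈gx ∷ ps) = ∙-cong fx≈gx (sumOf-congᴬ ps)

    sumOf-cong : {f g : A → R} (xs : List A) → (∀ x → f x ≈ g x) → sumOf f xs ≈ sumOf g xs
    sumOf-cong xs f≈g = sumOf-congᴬ {xs = xs} (All.tabulate (λ {x} _ → f≈g x))

    sumOf-∙ : (f g : A → R) (xs : List A) → sumOf f xs ∙ sumOf g xs ≈ sumOf (λ x → f x ∙ g x) xs
    sumOf-∙ f g []       = identityˡ ε
    sumOf-∙ f g (x ∷ xs) = begin
      (f x ∙ sumOf f xs) ∙ (g x ∙ sumOf g xs)  ≈⟨ interchange _ _ _ _ ⟩
      (f x ∙ g x) ∙ (sumOf f xs ∙ sumOf g xs)  ≈⟨ ∙-congˡ (sumOf-∙ f g xs) ⟩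
      (f x ∙ g x) ∙ sumOf (λ x → f x ∙ g x) xs ∎

    sumOf-partition : (f : A → R) (b : A → Bool) (xs : List A) →
      sumOf f (filter (λ x → T? (b x)) xs) ∙ sumOf f (filter (λ x → T? (not (b x))) xs) ≈ sumOf f xs
    sumOf-partition f b [] = identityˡ ε
    sumOf-partition f b (x ∷ xs) with b x
    ... | true  = ≈-trans (assoc _ _ _) (∙-congˡ (sumOf-partition f b xs))
    ... | false = ≈-trans (x∙yz≈y∙xz _ _ _) (∙-congˡ (sumOf-partition f b xs))

  module _ {A B : Set} where

    sumOf-map : (f : B → R) (g : A → B) (xs : List A) → sumOf f (map g xs) ≈ sumOf (λ x → f (g x)) xs
    sumOf-map f g []       = ≈-refl
    sumOf-map f g (x ∷ xs) = ∙-congˡ (sumOf-map f g xs)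

    sumOf-concatMap : (f : B → R) (g : A → List B) (xs : List A) →
                      sumOf f (concatMap g xs) ≈ sumOf (λ x → sumOf f (g x)) xs
    sumOf-concatMap f g []       = ≈-refl
    sumOf-concatMap f g (x ∷ xs) = ≈-trans (sumOf-++ f (g x) (concatMap g xs)) (∙-congˡ (sumOf-concatMap f g xs))

module ℕΣ where
  open ListSum ℕ.+-0-commutativeMonoid public

  sumOf-monoᴬ : {A : Set} {f g : A → ℕ} {xs : List A} → All (λ x → f x ℕ.≤ g x) xs → sumOf f xs ℕ.≤ sumOf g xs
  sumOf-monoᴬ []           = ℕ.z≤n
  sumOf-monoᴬ (fx≤gx ∷ ps) = ℕ.+-mono-≤ fx≤gx (sumOf-monoᴬ ps)

  sumOf-const : {A : Set} (c : ℕ) (xs : List A) → sumOf (λ _ → c) xs ≡ length xs ℕ.* c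
  sumOf-const c []       = refl
  sumOf-const c (x ∷ xs) = cong (c ℕ.+_) (sumOf-const c xs)

module ℚΣ where
  open ListSum ℚ-+-commutativeMonoid public

  module _ {A : Set} where

    sumOf-monoᴬ : {f g : A → ℚ} {xs : List A} → All (λ x → f x ≤ g x) xs → sumOf f xs ≤ sumOf g xs
    sumOf-monoᴬ []           = ≤-refl
    sumOf-monoᴬ (fx≤gx ∷ ps) = +-mono-≤ fx≤gx (sumOf-monoᴬ ps)

    sumOf-nonNeg : (f : A → ℚ) (xs : List A) → (∀ x → 0ℚ ≤ f x) → 0ℚ ≤ sumOf f xs
    sumOf-nonNeg f []       _   = ≤-refl
    sumOf-nonNeg f (x ∷ xs) f≥0 = +-mono-≤ (f≥0 x) (sumOf-nonNeg f xs f≥0)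

    *-sumOf : (c : ℚ) (f : A → ℚ) (xs : List A) → c * sumOf f xs ≡ sumOf (λ x → c * f x) xs
    *-sumOf c f []       = *-zeroʳ c
    *-sumOf c f (x ∷ xs) = trans (*-distribˡ-+ c (f x) (sumOf f xs)) (cong (_+_ (c * f x)) (*-sumOf c f xs))

    sumOf-const : (c : ℚ) (xs : List A) → sumOf (λ _ → c) xs ≡ ℕ→ℚ (length xs) * c
    sumOf-const c []       = sym (*-zeroˡ c)
    sumOf-const c (x ∷ xs) = begin
      c + sumOf (λ _ → c) xs        ≡⟨ cong (_+_ c) (sumOf-const c xs) ⟩
      c + ℕ→ℚ (length xs) * c       ≡⟨ solve 2 (λ c l → c :+ l :* c := (con 1ℚ :+ l) :* c) refl c (ℕ→ℚ (length xs)) ⟩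
      (1ℚ + ℕ→ℚ (length xs)) * c    ≡⟨ cong (_* c) (ℕ→ℚ-+ 1 (length xs)) ⟨
      ℕ→ℚ (length (x ∷ xs)) * c     ∎
      where open ≡-Reasoning

  ℕ→ℚ-sumOf : {A : Set} (f : A → ℕ) (xs : List A) → ℕ→ℚ (ℕΣ.sumOf f xs) ≡ sumOf (λ x → ℕ→ℚ (f x)) xs
  ℕ→ℚ-sumOf f []       = refl
  ℕ→ℚ-sumOf f (x ∷ xs) = trans (ℕ→ℚ-+ (f x) (ℕΣ.sumOf f xs)) (cong (_+_ (ℕ→ℚ (f x))) (ℕ→ℚ-sumOf f xs))

  sumOf-swap : {A B : Set} (a : A → ℚ) (g : A → B → ℚ) (xs : List A) (ys : List B) →
    sumOf (λ x → a x * sumOf (g x) ys) xs ≡ sumOf (λ y → sumOf (λ x → a x * g x y) xs) ys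
  sumOf-swap a g []       ys = trans (sym (*-zeroʳ (ℕ→ℚ (length ys)))) (sym (sumOf-const 0ℚ ys))
  sumOf-swap a g (x ∷ xs) ys = begin
    a x * sumOf (g x) ys + sumOf (λ x → a x * sumOf (g x) ys) xs
      ≡⟨ cong₂ _+_ (*-sumOf (a x) (g x) ys) (sumOf-swap a g xs ys) ⟩
    sumOf (λ y → a x * g x y) ys + sumOf (λ y → sumOf (λ x → a x * g x y) xs) ys
      ≡⟨ sumOf-∙ _ _ ys ⟩
    sumOf (λ y → sumOf (λ x → a x * g x y) (x ∷ xs)) ys ∎
    where open ≡-Reasoning

open ℚΣ

module _ {n : ℕ} where

  -- Boolean membership, so that it can be compared with `mem` on trees.
  infix 7 _∈ᵇ_
  _∈ᵇ_ : Fin n → List (Fin n) → Bool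
  x ∈ᵇ []       = false
  x ∈ᵇ (v ∷ vs) = ⌊ x ≟ v ⌋ ∨ x ∈ᵇ vs

  data Distinct : List (Fin n) → Set where
    []  : Distinct []
    _∷_ : ∀ {x xs} → x ∈ᵇ xs ≡ false → Distinct xs → Distinct (x ∷ xs)

  ≟-sym : (x y : Fin n) → ⌊ x ≟ y ⌋ ≡ ⌊ y ≟ x ⌋
  ≟-sym x y with x ≟ y | y ≟ x
  ... | yes _   | yes _   = refl
  ... | yes x≡y | no  y≢x = ⊥-elim (y≢x (sym x≡y))
  ... | no  x≢y | yes y≡x = ⊥-elim (x≢y (sym y≡x))
  ... | no  _   | no  _   = refl

  ∈ᵇ-↭ : ∀ x {xs ys} → xs ↭ ys → x ∈ᵇ xs ≡ x ∈ᵇ ys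
  ∈ᵇ-↭ x ↭.refl          = refl
  ∈ᵇ-↭ x (↭.prep v p)    = cong (⌊ x ≟ v ⌋ ∨_) (∈ᵇ-↭ x p)
  ∈ᵇ-↭ x (↭.swap {xs} u v p) =
    trans (∨-middle ⌊ x ≟ u ⌋ ⌊ x ≟ v ⌋ (x ∈ᵇ xs)) (cong (λ b → ⌊ x ≟ v ⌋ ∨ (⌊ x ≟ u ⌋ ∨ b)) (∈ᵇ-↭ x p))
  ∈ᵇ-↭ x (↭.trans p q)   = trans (∈ᵇ-↭ x p) (∈ᵇ-↭ x q)

  Distinct-↭ : ∀ {xs ys} → xs ↭ ys → Distinct xs → Distinct ys
  Distinct-↭ ↭.refl       d            = d
  Distinct-↭ (↭.prep x p) (x∉ ∷ d)     = trans (sym (∈ᵇ-↭ x p)) x∉ ∷ Distinct-↭ p d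
  Distinct-↭ (↭.swap {xs} {ys} x y p) (x∉ ∷ y∉ ∷ d) =
    (trans (cong (_∨ y ∈ᵇ ys) (trans (≟-sym y x) (∨-conicalˡ _ _ x∉))) (trans (sym (∈ᵇ-↭ y p)) y∉))
    ∷ trans (sym (∈ᵇ-↭ x p)) (∨-conicalʳ _ _ x∉) ∷ Distinct-↭ p d
  Distinct-↭ (↭.trans p q) d           = Distinct-↭ q (Distinct-↭ p d)

  ⌊≟⌋-refl : (x : Fin n) → ⌊ x ≟ x ⌋ ≡ true
  ⌊≟⌋-refl x with x ≟ x
  ... | yes _   = refl
  ... | no  x≢x = ⊥-elim (x≢x refl)

  ⌊≟⌋-≢ : {x y : Fin n} → x ≢ y → ⌊ x ≟ y ⌋ ≡ false
  ⌊≟⌋-≢ {x} {y} x≢y with x ≟ y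
  ... | yes x≡y = ⊥-elim (x≢y x≡y)
  ... | no  _   = refl

  ∈ᵇ-here : (x : Fin n) (xs : List (Fin n)) → x ∈ᵇ (x ∷ xs) ≡ true
  ∈ᵇ-here x xs = cong (_∨ x ∈ᵇ xs) (⌊≟⌋-refl x)

  ∈ᵇ-there : {x : Fin n} (y : Fin n) (xs : List (Fin n)) → x ∈ᵇ xs ≡ true → x ∈ᵇ (y ∷ xs) ≡ true
  ∈ᵇ-there {x} y xs x∈xs = trans (cong (⌊ x ≟ y ⌋ ∨_) x∈xs) (∨-zeroʳ ⌊ x ≟ y ⌋)

  ∈ᵇ-∷⁻ : {x y : Fin n} (xs : List (Fin n)) → x ≢ y → x ∈ᵇ (y ∷ xs) ≡ true → x ∈ᵇ xs ≡ true
  ∈ᵇ-∷⁻ {x} xs x≢y x∈ = trans (cong (_∨ x ∈ᵇ xs) (sym (⌊≟⌋-≢ x≢y))) x∈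

  ∉ᵇ-∷ : {x y : Fin n} (xs : List (Fin n)) → x ≢ y → x ∈ᵇ xs ≡ false → x ∈ᵇ (y ∷ xs) ≡ false
  ∉ᵇ-∷ {x} xs x≢y x∉xs = trans (cong (_∨ x ∈ᵇ xs) (⌊≟⌋-≢ x≢y)) x∉xs

  ∈ᵇ⇒↭-∷ : ∀ x xs → x ∈ᵇ xs ≡ true → ∃ λ rest → xs ↭ x ∷ rest
  ∈ᵇ⇒↭-∷ x (v ∷ vs) x∈ with x ≟ v
  ... | yes refl = vs , ↭.refl
  ... | no  _    with ∈ᵇ⇒↭-∷ x vs x∈
  ...   | rest , p = v ∷ rest , ↭.trans (↭.prep v p) (↭.swap v x ↭.refl)

  record IsSplit (S A B : List (Fin n)) : Set where
    field
      length-+ : length A ℕ.+ length B ≡ length S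
      ∈ᵇ-∨     : ∀ x → x ∈ᵇ A ∨ x ∈ᵇ B ≡ x ∈ᵇ S
      distinct : Distinct S → Distinct A × Distinct B

  splits-isSplit : ∀ S → All (uncurry (IsSplit S)) (splits S)
  splits-isSplit []       = record { length-+ = refl ; ∈ᵇ-∨ = λ _ → refl ; distinct = λ _ → [] , [] } ∷ []
  splits-isSplit (v ∷ vs) = ++⁺ (map⁺ (All.map toLeft (splits-isSplit vs)))
                                (map⁺ (All.map toRight (splits-isSplit vs)))
    where
    toLeft : ∀ {A B} → IsSplit vs A B → IsSplit (v ∷ vs) (v ∷ A) B
    toLeft {A} {B} s = record
      { length-+ = cong suc length-+
      ; ∈ᵇ-∨     = λ x → trans (∨-assoc ⌊ x ≟ v ⌋ _ _) (cong (⌊ x ≟ v ⌋ ∨_) (∈ᵇ-∨ x))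
      ; distinct = λ { (v∉ ∷ d) → let dA , dB = distinct d
                                  in (∨-conicalˡ _ _ (trans (∈ᵇ-∨ v) v∉) ∷ dA) , dB }
      }
      where open IsSplit s
    toRight : ∀ {A B} → IsSplit vs A B → IsSplit (v ∷ vs) A (v ∷ B)
    toRight {A} {B} s = record
      { length-+ = trans (ℕ.+-suc (length A) (length B)) (cong suc length-+)
      ; ∈ᵇ-∨     = λ x → trans (∨-middle (x ∈ᵇ A) ⌊ x ≟ v ⌋ (x ∈ᵇ B)) (cong (⌊ x ≟ v ⌋ ∨_) (∈ᵇ-∨ x))
      ; distinct = λ { (v∉ ∷ d) → let dA , dB = distinct d
                                  in dA , (∨-conicalʳ _ _ (trans (∈ᵇ-∨ v) v∉) ∷ dB) }
      }
      where open IsSplit s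

  IsProperSplit : (S A B : List (Fin n)) → Set
  IsProperSplit S A B = IsSplit S A B × 1 ℕ.≤ length A × 1 ℕ.≤ length B

  properSplits-isProperSplit : ∀ S → All (uncurry (IsProperSplit S)) (properSplits S)
  properSplits-isProperSplit S =
    All.zipWith (λ {ab} (s , ne) → s , nonEmpty (proj₁ ab) (proj₂ ab) ne) (filter⁺ _ (splits-isSplit S) , all-filter _ (splits S))
    where
    nonEmpty : ∀ A B → 𝔹.T (not (null A) ∧ not (null B)) → 1 ℕ.≤ length A × 1 ℕ.≤ length B
    nonEmpty (_ ∷ _) (_ ∷ _) _ = ℕ.s≤s ℕ.z≤n , ℕ.s≤s ℕ.z≤n

  properSplit-shorterˡ : ∀ {S A B} → IsProperSplit S A B → length A ℕ.< length S
  properSplit-shorterˡ {S} {A} {B} (s , _ , 1≤B) =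
    subst (length A ℕ.<_) (IsSplit.length-+ s) (ℕ.m<m+n (length A) 1≤B)

  properSplit-shorterʳ : ∀ {S A B} → IsProperSplit S A B → length B ℕ.< length S
  properSplit-shorterʳ {S} {A} {B} (s , 1≤A , _) =
    subst (length B ℕ.<_) (IsSplit.length-+ s) (ℕ.m<n+m (length B) 1≤A)

  singleton-∈-properSplits : ∀ (x y : Fin n) zs → ([ x ] , y ∷ zs) ∈ properSplits (x ∷ y ∷ zs)
  singleton-∈-properSplits x y zs =
    ∈-filter⁺ (λ p → T? (not (null (proj₁ p)) ∧ not (null (proj₂ p)))) (∈-++⁺ˡ (∈-map⁺ _ (allRight (y ∷ zs)))) _
    where
    allRight : ∀ xs → ([] , xs) ∈ splits xs
    allRight []       = here refl
    allRight (v ∷ vs) = ∈-++⁺ʳ _ (∈-map⁺ _ (allRight vs))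

  splitSum : (List (Fin n) → List (Fin n) → ℕ) → List (Fin n) → ℕ
  splitSum H S = ℕΣ.sumOf (uncurry H) (splits S)

  splitSum-∷ : ∀ H x xs → splitSum H (x ∷ xs) ≡ splitSum (λ A B → H (x ∷ A) B) xs ℕ.+ splitSum (λ A B → H A (x ∷ B)) xs
  splitSum-∷ H x xs = trans (ℕΣ.sumOf-++ (uncurry H) (map (λ p → x ∷ proj₁ p , proj₂ p) (splits xs)) _)
                            (cong₂ ℕ._+_ (ℕΣ.sumOf-map _ _ (splits xs)) (ℕΣ.sumOf-map _ _ (splits xs)))

  splitSum-∷-∷ : ∀ H x y zs → splitSum H (x ∷ y ∷ zs) ≡
    (splitSum (λ A B → H (x ∷ y ∷ A) B) zs ℕ.+ splitSum (λ A B → H (x ∷ A) (y ∷ B)) zs)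
    ℕ.+ (splitSum (λ A B → H (y ∷ A) (x ∷ B)) zs ℕ.+ splitSum (λ A B → H A (x ∷ y ∷ B)) zs)
  splitSum-∷-∷ H x y zs = trans (splitSum-∷ H x (y ∷ zs)) (cong₂ ℕ._+_ (splitSum-∷ _ y zs) (splitSum-∷ _ y zs))

  splitSum-placements : ∀ H x y zs → splitSum H (x ∷ y ∷ zs) ≡ splitSum (λ A B →
    (H (x ∷ y ∷ A) B ℕ.+ H (x ∷ A) (y ∷ B)) ℕ.+ (H (y ∷ A) (x ∷ B) ℕ.+ H A (x ∷ y ∷ B))) zs
  splitSum-placements H x y zs = trans (splitSum-∷-∷ H x y zs)
    (trans (cong₂ ℕ._+_ (ℕΣ.sumOf-∙ _ _ (splits zs)) (ℕΣ.sumOf-∙ _ _ (splits zs))) (ℕΣ.sumOf-∙ _ _ (splits zs)))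

  PermutationInvariant : (List (Fin n) → List (Fin n) → ℕ) → Set
  PermutationInvariant H = ∀ {A A′ B B′} → A ↭ A′ → B ↭ B′ → H A B ≡ H A′ B′

  private
    SplitSumInvariant : List (Fin n) → List (Fin n) → Set
    SplitSumInvariant xs ys = ∀ H → PermutationInvariant H → splitSum H xs ≡ splitSum H ys

    splitSum-prep : ∀ x {xs ys} → SplitSumInvariant xs ys → SplitSumInvariant (x ∷ xs) (x ∷ ys)
    splitSum-prep x {xs} {ys} eq H inv = begin
      splitSum H (x ∷ xs)                                                        ≡⟨ splitSum-∷ H x xs ⟩
      splitSum (λ A B → H (x ∷ A) B) xs ℕ.+ splitSum (λ A B → H A (x ∷ B)) xs
        ≡⟨ cong₂ ℕ._+_ (eq _ (λ a b → inv (↭.prep x a) b)) (eq _ (λ a b → inv a (↭.prep x b))) ⟩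
      splitSum (λ A B → H (x ∷ A) B) ys ℕ.+ splitSum (λ A B → H A (x ∷ B)) ys   ≡⟨ splitSum-∷ H x ys ⟨
      splitSum H (x ∷ ys)                                                        ∎
      where open ≡-Reasoning

    splitSum-swap : ∀ x y zs → SplitSumInvariant (x ∷ y ∷ zs) (y ∷ x ∷ zs)
    splitSum-swap x y zs H inv = begin
      splitSum H (x ∷ y ∷ zs)
        ≡⟨ expand x y ⟩
      (bothLeft x y ℕ.+ apart x y) ℕ.+ (apart y x ℕ.+ bothRight x y)
        ≡⟨ cong₂ (λ l r → (l ℕ.+ apart x y) ℕ.+ (apart y x ℕ.+ r))
                 (splitSum-cong (λ A B → inv (↭.swap x y ↭.refl) (↭.refl {xs = B})))
                 (splitSum-cong (λ A B → inv (↭.refl {xs = A}) (↭.swap x y ↭.refl))) ⟩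
      (bothLeft y x ℕ.+ apart x y) ℕ.+ (apart y x ℕ.+ bothRight y x)
        ≡⟨ middleSwap (bothLeft y x) (apart x y) (apart y x) (bothRight y x) ⟩
      (bothLeft y x ℕ.+ apart y x) ℕ.+ (apart x y ℕ.+ bothRight y x)
        ≡⟨ expand y x ⟨
      splitSum H (y ∷ x ∷ zs)
        ∎
      where
      open ≡-Reasoning
      bothLeft apart bothRight : Fin n → Fin n → ℕ
      bothLeft  u v = splitSum (λ A B → H (u ∷ v ∷ A) B) zs
      apart     u v = splitSum (λ A B → H (u ∷ A) (v ∷ B)) zs
      bothRight u v = splitSum (λ A B → H A (u ∷ v ∷ B)) zs
      expand : ∀ u v → splitSum H (u ∷ v ∷ zs) ≡ (bothLeft u v ℕ.+ apart u v) ℕ.+ (apart v u ℕ.+ bothRight u v)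
      expand u v = splitSum-∷-∷ H u v zs
      splitSum-cong : ∀ {G G′} → (∀ A B → G A B ≡ G′ A B) → splitSum G zs ≡ splitSum G′ zs
      splitSum-cong G≡G′ = ℕΣ.sumOf-cong (splits zs) (λ (A , B) → G≡G′ A B)
      middleSwap : ∀ a b c d → (a ℕ.+ b) ℕ.+ (c ℕ.+ d) ≡ (a ℕ.+ c) ℕ.+ (b ℕ.+ d)
      middleSwap = solve-∀

  splitSum-↭ : ∀ {xs ys} → xs ↭ ys → ∀ H → PermutationInvariant H → splitSum H xs ≡ splitSum H ys
  splitSum-↭ ↭.refl                 H inv = refl
  splitSum-↭ (↭.prep {xs} {ys} x p) = splitSum-prep x {xs} {ys} (splitSum-↭ p)
  splitSum-↭ (↭.swap {xs = zs} {ys = zs′} x y p) H inv =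
    trans (splitSum-prep x {y ∷ zs} {y ∷ zs′} (splitSum-prep y {zs} {zs′} (splitSum-↭ p)) H inv) (splitSum-swap x y zs′ H inv)
  splitSum-↭ (↭.trans p q)          H inv = trans (splitSum-↭ p H inv) (splitSum-↭ q H inv)

-- Random Partitioning as a distribution over trees

Distribution : ℕ → Set
Distribution n = List (ℚ × Tree n)

module _ {n : ℕ} where

  mass : Distribution n → ℚ
  mass = sumOf proj₁

  expect : (Tree n → ℚ) → Distribution n → ℚ
  expect X = sumOf (λ pt → proj₁ pt * X (proj₂ pt))

  expect-congᴬ : ∀ {X Y : Tree n → ℚ} {d} → All (λ pt → X (proj₂ pt) ≡ Y (proj₂ pt)) d → expect X d ≡ expect Y d
  expect-congᴬ eqs = sumOf-congᴬ (All.map (λ {pt} → cong (proj₁ pt *_)) eqs)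

  expect-cong : ∀ {X Y : Tree n → ℚ} d → (∀ t → X t ≡ Y t) → expect X d ≡ expect Y d
  expect-cong d X≡Y = sumOf-cong d (λ pt → cong (proj₁ pt *_) (X≡Y (proj₂ pt)))

  expect-const : ∀ c d → expect (λ _ → c) d ≡ c * mass d
  expect-const c d = trans (sumOf-cong d (λ pt → *-comm (proj₁ pt) c)) (sym (*-sumOf c proj₁ d))

  expect-const-unitMass : ∀ c d → mass d ≡ 1ℚ → expect (λ _ → c) d ≡ c
  expect-const-unitMass c d d≡1 = trans (expect-const c d) (trans (cong (c *_) d≡1) (*-identityʳ c))

  joint : ℚ → Distribution n → Distribution n → Distribution n
  joint u dA dB = concatMap (λ pt → map (λ qt → (u * proj₁ pt * proj₁ qt , node (proj₂ pt) (proj₂ qt))) dB) dA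

  expect-joint : ∀ X u dA dB → expect X (joint u dA dB) ≡ u * expect (λ tA → expect (λ tB → X (node tA tB)) dB) dA
  expect-joint X u dA dB = begin
    expect X (joint u dA dB)
      ≡⟨ sumOf-concatMap _ _ dA ⟩
    sumOf (λ pt → expect X (map (λ qt → (u * proj₁ pt * proj₁ qt , node (proj₂ pt) (proj₂ qt))) dB)) dA
      ≡⟨ sumOf-cong dA (λ pt → trans (sumOf-map _ _ dB) (inner pt)) ⟩
    sumOf (λ pt → u * (proj₁ pt * expect (λ tB → X (node (proj₂ pt) tB)) dB)) dA
      ≡⟨ *-sumOf u _ dA ⟨
    u * expect (λ tA → expect (λ tB → X (node tA tB)) dB) dA
      ∎
    where
    open ≡-Reasoning
    inner : ∀ pt → sumOf (λ qt → (u * proj₁ pt * proj₁ qt) * X (node (proj₂ pt) (proj₂ qt))) dB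
                   ≡ u * (proj₁ pt * expect (λ tB → X (node (proj₂ pt) tB)) dB)
    inner (p , t) = begin
      sumOf (λ qt → (u * p * proj₁ qt) * X (node t (proj₂ qt))) dB
        ≡⟨ sumOf-cong dB (λ qt → trans (*-assoc (u * p) _ _) (*-assoc u p _)) ⟩
      sumOf (λ qt → u * (p * (proj₁ qt * X (node t (proj₂ qt))))) dB
        ≡⟨ *-sumOf u _ dB ⟨
      u * sumOf (λ qt → p * (proj₁ qt * X (node t (proj₂ qt)))) dB
        ≡⟨ cong (u *_) (*-sumOf p _ dB) ⟨
      u * (p * expect (λ tB → X (node t tB)) dB)
        ∎

  mass-joint : ∀ u dA dB → mass dA ≡ 1ℚ → mass dB ≡ 1ℚ → mass (joint u dA dB) ≡ u
  mass-joint u dA dB dA≡1 dB≡1 = begin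
    mass (joint u dA dB)                                  ≡⟨ mass≡expect (joint u dA dB) ⟩
    expect (λ _ → 1ℚ) (joint u dA dB)                     ≡⟨ expect-joint (λ _ → 1ℚ) u dA dB ⟩
    u * expect (λ _ → expect (λ _ → 1ℚ) dB) dA
      ≡⟨ cong (u *_) (expect-cong dA (λ _ → expect-const-unitMass 1ℚ dB dB≡1)) ⟩
    u * expect (λ _ → 1ℚ) dA                              ≡⟨ cong (u *_) (expect-const-unitMass 1ℚ dA dA≡1) ⟩
    u * 1ℚ                                                ≡⟨ *-identityʳ u ⟩
    u                                                     ∎
    where
    open ≡-Reasoning
    mass≡expect : ∀ d → mass d ≡ expect (λ _ → 1ℚ) d
    mass≡expect d = trans (sym (*-identityˡ (mass d))) (sym (expect-const 1ℚ d))

unif-nonNeg : ∀ k → NonNegative (unif k)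
unif-nonNeg zero    = _
unif-nonNeg (suc k) = normalize-nonNeg 1 (suc k)

ℕ→ℚ-*-unif : {A : Set} {x : A} {xs : List A} → x ∈ xs → ℕ→ℚ (length xs) * unif (length xs) ≡ 1ℚ
ℕ→ℚ-*-unif {xs = _ ∷ xs} _ = ℕ→ℚ-*-inverse (length xs)

module _ {n : ℕ} where

  record HasLeaves (t : Tree n) (S : List (Fin n)) : Set where
    field
      mem-≡    : ∀ x → mem x t ≡ x ∈ᵇ S
      leaves-≡ : leaves t ≡ length S

  node-hasLeaves : ∀ {S A B tA tB} → IsSplit S A B → HasLeaves tA A → HasLeaves tB B → HasLeaves (node tA tB) S
  node-hasLeaves s hA hB = record
    { mem-≡    = λ x → trans (cong₂ _∨_ (HasLeaves.mem-≡ hA x) (HasLeaves.mem-≡ hB x)) (IsSplit.∈ᵇ-∨ s x)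
    ; leaves-≡ = trans (cong₂ ℕ._+_ (HasLeaves.leaves-≡ hA) (HasLeaves.leaves-≡ hB)) (IsSplit.length-+ s)
    }

  rp-hasLeaves : ∀ f S → All (λ pt → HasLeaves (proj₂ pt) S) (rp f S)
  rp-hasLeaves _       []              = []
  rp-hasLeaves _       (v ∷ [])        = record { mem-≡ = λ x → sym (∨-identityʳ ⌊ x ≟ v ⌋) ; leaves-≡ = refl } ∷ []
  rp-hasLeaves zero    (_ ∷ _ ∷ _)     = []
  rp-hasLeaves (suc f) S@(_ ∷ _ ∷ _)   =
    concat⁺ (map⁺ (All.map (λ {ab} (s , _) → jointLeaves {unif (length (properSplits S))} s
                                               (rp-hasLeaves f (proj₁ ab)) (rp-hasLeaves f (proj₂ ab)))
                           (properSplits-isProperSplit S)))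
    where
    jointLeaves : ∀ {u A B dA dB} → IsSplit S A B →
      All (λ pt → HasLeaves (proj₂ pt) A) dA → All (λ pt → HasLeaves (proj₂ pt) B) dB →
      All (λ pt → HasLeaves (proj₂ pt) S) (joint u dA dB)
    jointLeaves s hAs hBs = concat⁺ (map⁺ (All.map (λ hA → map⁺ (All.map (node-hasLeaves s hA) hBs)) hAs))

  rp-mass : ∀ f (S : List (Fin n)) → 1 ℕ.≤ length S → length S ℕ.≤ f → mass (rp f S) ≡ 1ℚ
  rp-mass _       (v ∷ [])          _ _      = +-identityʳ 1ℚ
  rp-mass (suc f) S@(x ∷ y ∷ zs)    _ S≤1+f  = begin
    mass (rp (suc f) S)                                            ≡⟨ sumOf-concatMap proj₁ _ (properSplits S) ⟩
    sumOf (λ ab → mass (joint u (rp f (proj₁ ab)) (rp f (proj₂ ab)))) (properSplits S)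
      ≡⟨ sumOf-congᴬ (All.map (λ {ab} ps → mass-joint u (rp f (proj₁ ab)) (rp f (proj₂ ab))
                                             (rp-mass f (proj₁ ab) (proj₁ (proj₂ ps)) (fuelˡ ps))
                                             (rp-mass f (proj₂ ab) (proj₂ (proj₂ ps)) (fuelʳ ps)))
                              (properSplits-isProperSplit S)) ⟩
    sumOf (λ _ → u) (properSplits S)                               ≡⟨ sumOf-const u (properSplits S) ⟩
    ℕ→ℚ (length (properSplits S)) * u                              ≡⟨ ℕ→ℚ-*-unif (singleton-∈-properSplits x y zs) ⟩
    1ℚ                                                             ∎
    where
    open ≡-Reasoning
    u = unif (length (properSplits S))
    fuelˡ : ∀ {A B} → IsProperSplit S A B → length A ℕ.≤ f
    fuelˡ ps = ℕ.≤-pred (ℕ.<-≤-trans (properSplit-shorterˡ ps) S≤1+f)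
    fuelʳ : ∀ {A B} → IsProperSplit S A B → length B ℕ.≤ f
    fuelʳ ps = ℕ.≤-pred (ℕ.<-≤-trans (properSplit-shorterʳ ps) S≤1+f)

-- The expected size of T_ij under Random Partitioning

module _ {n : ℕ} (i j : Fin n) where

  bothIn : List (Fin n) → Bool
  bothIn A = i ∈ᵇ A ∧ j ∈ᵇ A

  -- Three times the lower bound on E|T_ij| once the first split of a
  -- cluster of m vertices is (A , B).
  splitBound : ℕ → List (Fin n) → List (Fin n) → ℕ
  splitBound m A B = if bothIn A then 2 ℕ.* length A else if bothIn B then 2 ℕ.* length B else 3 ℕ.* m

  splitBound-↭ : ∀ m → PermutationInvariant (splitBound m)
  splitBound-↭ m A↭A′ B↭B′
    rewrite ∈ᵇ-↭ i A↭A′ | ∈ᵇ-↭ j A↭A′ | ∈ᵇ-↭ i B↭B′ | ∈ᵇ-↭ j B↭B′ | ↭-length A↭A′ | ↭-length B↭B′ = refl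

  splitBound-left : ∀ m A B → bothIn A ≡ true → splitBound m A B ≡ 2 ℕ.* length A
  splitBound-left m A B A∋ij rewrite A∋ij = refl

  splitBound-right : ∀ m A B → bothIn A ≡ false → bothIn B ≡ true → splitBound m A B ≡ 2 ℕ.* length B
  splitBound-right m A B A∌ij B∋ij rewrite A∌ij | B∋ij = refl

  splitBound-apart : ∀ m A B → bothIn A ≡ false → bothIn B ≡ false → splitBound m A B ≡ 3 ℕ.* m
  splitBound-apart m A B A∌ij B∌ij rewrite A∌ij | B∌ij = refl

  bothIn-∌ˡ : ∀ C → i ∈ᵇ C ≡ false → bothIn C ≡ false
  bothIn-∌ˡ C i∉C rewrite i∉C = refl

  bothIn-∌ʳ : ∀ C → j ∈ᵇ C ≡ false → bothIn C ≡ false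
  bothIn-∌ʳ C j∉C rewrite j∉C = ∧-zeroʳ (i ∈ᵇ C)

  bothIn-∷-∷ : ∀ C → bothIn (i ∷ j ∷ C) ≡ true
  bothIn-∷-∷ C = cong₂ _∧_ (∈ᵇ-here i (j ∷ C)) (∈ᵇ-there i (j ∷ C) (∈ᵇ-here j C))

  improperSplit-splitBound : ∀ {S} A B → IsSplit S A B → i ∈ᵇ S ≡ true → j ∈ᵇ S ≡ true →
    𝔹.T (not (not (null A) ∧ not (null B))) → splitBound (length S) A B ≡ 2 ℕ.* length S
  improperSplit-splitBound {S} [] B s i∈S j∈S _ =
    trans (splitBound-right (length S) [] B refl (cong₂ _∧_ (trans (∈ᵇ-∨ i) i∈S) (trans (∈ᵇ-∨ j) j∈S)))
          (cong (2 ℕ.*_) length-+)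
    where open IsSplit s
  improperSplit-splitBound {S} A@(_ ∷ _) [] s i∈S j∈S _ =
    trans (splitBound-left (length S) A [] (cong₂ _∧_ (onlyLeft i i∈S) (onlyLeft j j∈S)))
          (cong (2 ℕ.*_) (trans (sym (ℕ.+-identityʳ (length A))) length-+))
    where
    open IsSplit s
    onlyLeft : ∀ x → x ∈ᵇ S ≡ true → x ∈ᵇ A ≡ true
    onlyLeft x x∈S = trans (sym (∨-identityʳ (x ∈ᵇ A))) (trans (∈ᵇ-∨ x) x∈S)

  lcaSizeℚ : Tree n → ℚ
  lcaSizeℚ t = ℕ→ℚ (lcaSize t i j)

  lcaSize-node : ∀ {A B tA tB} → HasLeaves tA A → HasLeaves tB B → lcaSize (node tA tB) i j ≡
    (if bothIn A then lcaSize tA i j else if bothIn B then lcaSize tB i j else length A ℕ.+ length B)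
  lcaSize-node hA hB rewrite HasLeaves.mem-≡ hA i | HasLeaves.mem-≡ hA j | HasLeaves.mem-≡ hB i | HasLeaves.mem-≡ hB j
                           | HasLeaves.leaves-≡ hA | HasLeaves.leaves-≡ hB = refl

  splitBound-≤-expect : ∀ {S A B} (dA dB : Distribution n) → IsSplit S A B →
    All (λ pt → HasLeaves (proj₂ pt) A) dA → All (λ pt → HasLeaves (proj₂ pt) B) dB →
    mass dA ≡ 1ℚ → mass dB ≡ 1ℚ →
    (bothIn A ≡ true → + 2 / 3 * ℕ→ℚ (length A) ≤ expect lcaSizeℚ dA) →
    (bothIn B ≡ true → + 2 / 3 * ℕ→ℚ (length B) ≤ expect lcaSizeℚ dB) →
    + 1 / 3 * ℕ→ℚ (splitBound (length S) A B) ≤ expect (λ tA → expect (λ tB → lcaSizeℚ (node tA tB)) dB) dA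
  splitBound-≤-expect {S} {A} {B} dA dB s hAs hBs dA≡1 dB≡1 boundA boundB = byCases (bothIn A) refl (bothIn B) refl
    where
    open ≤-Reasoning
    m = length S
    E : ℚ
    E = expect (λ tA → expect (λ tB → lcaSizeℚ (node tA tB)) dB) dA
    onSupports : ∀ {Y : Tree n → Tree n → ℚ} →
                 (∀ {tA tB} → HasLeaves tA A → HasLeaves tB B → lcaSizeℚ (node tA tB) ≡ Y tA tB) →
                 E ≡ expect (λ tA → expect (λ tB → Y tA tB) dB) dA
    onSupports eq = expect-congᴬ (All.map (λ hA → expect-congᴬ (All.map (λ hB → eq hA hB) hBs)) hAs)
    lcaSize-node-≡ : ∀ {a b tA tB} → bothIn A ≡ a → bothIn B ≡ b → HasLeaves tA A → HasLeaves tB B →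
      lcaSizeℚ (node tA tB) ≡ ℕ→ℚ (if a then lcaSize tA i j else if b then lcaSize tB i j else length A ℕ.+ length B)
    lcaSize-node-≡ refl refl hA hB = cong ℕ→ℚ (lcaSize-node hA hB)
    byCases : ∀ a → bothIn A ≡ a → ∀ b → bothIn B ≡ b → + 1 / 3 * ℕ→ℚ (splitBound m A B) ≤ E
    byCases true A∋ij _ B? = begin
      + 1 / 3 * ℕ→ℚ (splitBound m A B)              ≡⟨ cong (λ g → + 1 / 3 * ℕ→ℚ g) (splitBound-left m A B A∋ij) ⟩
      + 1 / 3 * ℕ→ℚ (2 ℕ.* length A)                ≡⟨ ⅓-ℕ→ℚ-2* (length A) ⟩
      + 2 / 3 * ℕ→ℚ (length A)                      ≤⟨ boundA A∋ij ⟩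
      expect lcaSizeℚ dA                            ≡⟨ expect-cong dA (λ tA → expect-const-unitMass (lcaSizeℚ tA) dB dB≡1) ⟨
      expect (λ tA → expect (λ _ → lcaSizeℚ tA) dB) dA ≡⟨ onSupports (lcaSize-node-≡ A∋ij B?) ⟨
      E                                             ∎
    byCases false A∌ij true B∋ij = begin
      + 1 / 3 * ℕ→ℚ (splitBound m A B)              ≡⟨ cong (λ g → + 1 / 3 * ℕ→ℚ g) (splitBound-right m A B A∌ij B∋ij) ⟩
      + 1 / 3 * ℕ→ℚ (2 ℕ.* length B)                ≡⟨ ⅓-ℕ→ℚ-2* (length B) ⟩
      + 2 / 3 * ℕ→ℚ (length B)                      ≤⟨ boundB B∋ij ⟩
      expect lcaSizeℚ dB                            ≡⟨ expect-const-unitMass (expect lcaSizeℚ dB) dA dA≡1 ⟨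
      expect (λ _ → expect lcaSizeℚ dB) dA          ≡⟨ onSupports (lcaSize-node-≡ A∌ij B∋ij) ⟨
      E                                             ∎
    byCases false A∌ij false B∌ij = begin
      + 1 / 3 * ℕ→ℚ (splitBound m A B)              ≡⟨ cong (λ g → + 1 / 3 * ℕ→ℚ g) (splitBound-apart m A B A∌ij B∌ij) ⟩
      + 1 / 3 * ℕ→ℚ (3 ℕ.* m)                       ≡⟨ ⅓-ℕ→ℚ-3* m ⟩
      ℕ→ℚ m                                         ≡⟨ cong ℕ→ℚ (IsSplit.length-+ s) ⟨
      ℕ→ℚ (length A ℕ.+ length B)                   ≡⟨ expect-const-unitMass _ dA dA≡1 ⟨
      expect (λ _ → ℕ→ℚ (length A ℕ.+ length B)) dA ≡⟨ expect-cong dA (λ _ → expect-const-unitMass _ dB dB≡1) ⟨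
      expect (λ _ → expect (λ _ → ℕ→ℚ (length A ℕ.+ length B)) dB) dA ≡⟨ onSupports (lcaSize-node-≡ A∌ij B∌ij) ⟨
      E                                             ∎

  module _ (i≢j : i ≢ j) where

    placements-splitBound : ∀ {m r A B} → m ≡ 2 ℕ.+ (length A ℕ.+ length B) → IsSplit r A B →
      i ∈ᵇ r ≡ false → j ∈ᵇ r ≡ false →
      (2 ℕ.* m ℕ.+ 2 ℕ.* m) ℕ.+ (2 ℕ.* m ℕ.+ 2 ℕ.* m) ℕ.≤
      (splitBound m (i ∷ j ∷ A) B ℕ.+ splitBound m (i ∷ A) (j ∷ B))
        ℕ.+ (splitBound m (j ∷ A) (i ∷ B) ℕ.+ splitBound m A (i ∷ j ∷ B))
    placements-splitBound {r = r} {A} {B} refl s i∉r j∉r = begin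
      (2 ℕ.* m ℕ.+ 2 ℕ.* m) ℕ.+ (2 ℕ.* m ℕ.+ 2 ℕ.* m)
        ≤⟨ ℕ.m≤n+m _ 4 ⟩
      4 ℕ.+ ((2 ℕ.* m ℕ.+ 2 ℕ.* m) ℕ.+ (2 ℕ.* m ℕ.+ 2 ℕ.* m))
        ≡⟨ count (length A) (length B) ⟩
      (2 ℕ.* length (i ∷ j ∷ A) ℕ.+ 3 ℕ.* m) ℕ.+ (3 ℕ.* m ℕ.+ 2 ℕ.* length (i ∷ j ∷ B))
        ≡⟨ cong₂ ℕ._+_ (cong₂ ℕ._+_ (sym (splitBound-left m (i ∷ j ∷ A) B (bothIn-∷-∷ A)))
                                    (sym (splitBound-apart m (i ∷ A) (j ∷ B) (bothIn-∌ʳ (i ∷ A) (∉ᵇ-∷ A j≢i j∉A))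
                                                                           (bothIn-∌ˡ (j ∷ B) (∉ᵇ-∷ B i≢j i∉B)))))
                       (cong₂ ℕ._+_ (sym (splitBound-apart m (j ∷ A) (i ∷ B) (bothIn-∌ˡ (j ∷ A) (∉ᵇ-∷ A i≢j i∉A))
                                                                           (bothIn-∌ʳ (i ∷ B) (∉ᵇ-∷ B j≢i j∉B))))
                                    (sym (splitBound-right m A (i ∷ j ∷ B) (bothIn-∌ˡ A i∉A) (bothIn-∷-∷ B)))) ⟩
      (splitBound m (i ∷ j ∷ A) B ℕ.+ splitBound m (i ∷ A) (j ∷ B))
        ℕ.+ (splitBound m (j ∷ A) (i ∷ B) ℕ.+ splitBound m A (i ∷ j ∷ B))
        ∎
      where
      open ℕ.≤-Reasoning
      m = 2 ℕ.+ (length A ℕ.+ length B)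
      j≢i : j ≢ i
      j≢i = i≢j ∘ sym
      i∉A : i ∈ᵇ A ≡ false
      i∉A = ∨-conicalˡ (i ∈ᵇ A) (i ∈ᵇ B) (trans (IsSplit.∈ᵇ-∨ s i) i∉r)
      i∉B : i ∈ᵇ B ≡ false
      i∉B = ∨-conicalʳ (i ∈ᵇ A) (i ∈ᵇ B) (trans (IsSplit.∈ᵇ-∨ s i) i∉r)
      j∉A : j ∈ᵇ A ≡ false
      j∉A = ∨-conicalˡ (j ∈ᵇ A) (j ∈ᵇ B) (trans (IsSplit.∈ᵇ-∨ s j) j∉r)
      j∉B : j ∈ᵇ B ≡ false
      j∉B = ∨-conicalʳ (j ∈ᵇ A) (j ∈ᵇ B) (trans (IsSplit.∈ᵇ-∨ s j) j∉r)
      count : ∀ a b → let m = 2 ℕ.+ (a ℕ.+ b) in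
        4 ℕ.+ ((2 ℕ.* m ℕ.+ 2 ℕ.* m) ℕ.+ (2 ℕ.* m ℕ.+ 2 ℕ.* m))
          ≡ (2 ℕ.* (2 ℕ.+ a) ℕ.+ 3 ℕ.* m) ℕ.+ (3 ℕ.* m ℕ.+ 2 ℕ.* (2 ℕ.+ b))
      count = solve-∀

    splitSum-splitBound : ∀ S → Distinct S → i ∈ᵇ S ≡ true → j ∈ᵇ S ≡ true →
      splitSum (λ _ _ → 2 ℕ.* length S) S ℕ.≤ splitSum (splitBound (length S)) S
    splitSum-splitBound S dS i∈S j∈S with ∈ᵇ⇒↭-∷ i S i∈S
    ... | r₁ , S↭i∷r₁ with ∈ᵇ⇒↭-∷ j r₁ (∈ᵇ-∷⁻ r₁ (i≢j ∘ sym) (trans (sym (∈ᵇ-↭ j S↭i∷r₁)) j∈S))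
    ...   | r , r₁↭j∷r with Distinct-↭ (↭.trans S↭i∷r₁ (↭.prep i r₁↭j∷r)) dS
    ...     | i∉j∷r ∷ j∉r ∷ _ = begin
      splitSum C S                    ≡⟨ splitSum-↭ S↭i∷j∷r C (λ _ _ → refl) ⟩
      splitSum C (i ∷ j ∷ r)          ≡⟨ splitSum-placements C i j r ⟩
      splitSum (placed C) r
        ≤⟨ ℕΣ.sumOf-monoᴬ (All.map (λ s → placements-splitBound (m≡ s) s i∉r j∉r) (splits-isSplit r)) ⟩
      splitSum (placed G) r           ≡⟨ splitSum-placements G i j r ⟨
      splitSum G (i ∷ j ∷ r)          ≡⟨ splitSum-↭ S↭i∷j∷r G (splitBound-↭ (length S)) ⟨
      splitSum G S                    ∎
      where
      open ℕ.≤-Reasoning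
      S↭i∷j∷r = ↭.trans S↭i∷r₁ (↭.prep i r₁↭j∷r)
      i∉r = ∨-conicalʳ ⌊ i ≟ j ⌋ (i ∈ᵇ r) i∉j∷r
      C G : List (Fin n) → List (Fin n) → ℕ
      C _ _ = 2 ℕ.* length S
      G = splitBound (length S)
      placed : (List (Fin n) → List (Fin n) → ℕ) → List (Fin n) → List (Fin n) → ℕ
      placed H A B = (H (i ∷ j ∷ A) B ℕ.+ H (i ∷ A) (j ∷ B)) ℕ.+ (H (j ∷ A) (i ∷ B) ℕ.+ H A (i ∷ j ∷ B))
      m≡ : ∀ {A B} → IsSplit r A B → length S ≡ 2 ℕ.+ (length A ℕ.+ length B)
      m≡ s = trans (↭-length S↭i∷j∷r) (cong (2 ℕ.+_) (sym (IsSplit.length-+ s)))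

    properSplits-splitBound : ∀ S → Distinct S → i ∈ᵇ S ≡ true → j ∈ᵇ S ≡ true →
      length (properSplits S) ℕ.* (2 ℕ.* length S) ℕ.≤ ℕΣ.sumOf (uncurry (splitBound (length S))) (properSplits S)
    properSplits-splitBound S dS i∈S j∈S = ℕ.+-cancelʳ-≤ X _ _ (begin
      length (properSplits S) ℕ.* m ℕ.+ X           ≡⟨ cong (ℕ._+ X) (ℕΣ.sumOf-const m (properSplits S)) ⟨
      ℕΣ.sumOf (λ _ → m) (properSplits S) ℕ.+ X     ≡⟨ ℕΣ.sumOf-partition (λ _ → m) proper (splits S) ⟩
      splitSum (λ _ _ → m) S                        ≤⟨ splitSum-splitBound S dS i∈S j∈S ⟩
      splitSum G S                                  ≡⟨ ℕΣ.sumOf-partition (uncurry G) proper (splits S) ⟨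
      ℕΣ.sumOf (uncurry G) (properSplits S) ℕ.+ ℕΣ.sumOf (uncurry G) improper
        ≡⟨ cong (ℕΣ.sumOf (uncurry G) (properSplits S) ℕ.+_) (ℕΣ.sumOf-congᴬ improper-G≡m) ⟩
      ℕΣ.sumOf (uncurry G) (properSplits S) ℕ.+ X   ∎)
      where
      open ℕ.≤-Reasoning
      m = 2 ℕ.* length S
      G = splitBound (length S)
      proper : List (Fin n) × List (Fin n) → Bool
      proper (A , B) = not (null A) ∧ not (null B)
      improper = filter (λ p → T? (not (proper p))) (splits S)
      X = ℕΣ.sumOf (λ _ → m) improper
      improper-G≡m : All (λ p → uncurry G p ≡ m) improper
      improper-G≡m = All.zipWith (λ {p} (s , imp) → improperSplit-splitBound (proj₁ p) (proj₂ p) s i∈S j∈S imp)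
                                 (filter⁺ _ (splits-isSplit S) , all-filter _ (splits S))

    expect-lcaSize-rp-≥ : ∀ f S → length S ℕ.≤ f → Distinct S → i ∈ᵇ S ≡ true → j ∈ᵇ S ≡ true →
      + 2 / 3 * ℕ→ℚ (length S) ≤ expect lcaSizeℚ (rp f S)
    expect-lcaSize-rp-≥ _       (v ∷ [])        _     _  i∈S j∈S = ⊥-elim (i≢j (trans (only i∈S) (sym (only j∈S))))
      where
      only : ∀ {x} → x ∈ᵇ (v ∷ []) ≡ true → x ≡ v
      only {x} x∈ with x ≟ v
      ... | yes x≡v = x≡v
    expect-lcaSize-rp-≥ (suc f) S@(x ∷ y ∷ zs) S≤1+f dS i∈S j∈S = begin
      + 2 / 3 * ℕ→ℚ m
        ≡⟨ averageOfConst ⟩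
      u * (+ 1 / 3 * ℕ→ℚ (k ℕ.* (2 ℕ.* m)))
        ≤⟨ *-monoˡ-≤-nonNeg u {{unif-nonNeg k}} (*-monoˡ-≤-nonNeg (+ 1 / 3) {{normalize-nonNeg 1 3}}
             (ℕ→ℚ-mono (properSplits-splitBound S dS i∈S j∈S))) ⟩
      u * (+ 1 / 3 * ℕ→ℚ (ℕΣ.sumOf (uncurry G) (properSplits S)))
        ≡⟨ cong (λ q → u * (+ 1 / 3 * q)) (ℕ→ℚ-sumOf (uncurry G) (properSplits S)) ⟩
      u * (+ 1 / 3 * sumOf (λ ab → ℕ→ℚ (uncurry G ab)) (properSplits S))
        ≡⟨ trans (cong (u *_) (*-sumOf (+ 1 / 3) (λ ab → ℕ→ℚ (uncurry G ab)) (properSplits S)))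
                 (*-sumOf u (λ ab → + 1 / 3 * ℕ→ℚ (uncurry G ab)) (properSplits S)) ⟩
      sumOf (λ ab → u * (+ 1 / 3 * ℕ→ℚ (uncurry G ab))) (properSplits S)
        ≤⟨ sumOf-monoᴬ (All.map (λ {ab} ps → *-monoˡ-≤-nonNeg u {{unif-nonNeg k}} (perSplit ab ps)) (properSplits-isProperSplit S)) ⟩
      sumOf (λ ab → u * conditional ab) (properSplits S)
        ≡⟨ sumOf-cong (properSplits S) (λ ab → expect-joint lcaSizeℚ u (rp f (proj₁ ab)) (rp f (proj₂ ab))) ⟨
      sumOf (λ ab → expect lcaSizeℚ (joint u (rp f (proj₁ ab)) (rp f (proj₂ ab)))) (properSplits S)
        ≡⟨ sumOf-concatMap _ _ (properSplits S) ⟨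
      expect lcaSizeℚ (rp (suc f) S)
        ∎
      where
      open ≤-Reasoning
      m = length S
      k = length (properSplits S)
      u = unif k
      G = splitBound m
      conditional : List (Fin n) × List (Fin n) → ℚ
      conditional (A , B) = expect (λ tA → expect (λ tB → lcaSizeℚ (node tA tB)) (rp f B)) (rp f A)
      averageOfConst : + 2 / 3 * ℕ→ℚ m ≡ u * (+ 1 / 3 * ℕ→ℚ (k ℕ.* (2 ℕ.* m)))
      averageOfConst = sym (begin-equality
        u * (+ 1 / 3 * ℕ→ℚ (k ℕ.* (2 ℕ.* m)))                  ≡⟨ cong (λ q → u * (+ 1 / 3 * q)) (ℕ→ℚ-* k (2 ℕ.* m)) ⟩
        u * (+ 1 / 3 * (ℕ→ℚ k * ℕ→ℚ (2 ℕ.* m)))                ≡⟨ rearrange u (+ 1 / 3) (ℕ→ℚ k) (ℕ→ℚ (2 ℕ.* m)) ⟩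
        (ℕ→ℚ k * u) * (+ 1 / 3 * ℕ→ℚ (2 ℕ.* m))
          ≡⟨ cong (_* (+ 1 / 3 * ℕ→ℚ (2 ℕ.* m))) (ℕ→ℚ-*-unif (singleton-∈-properSplits x y zs)) ⟩
        1ℚ * (+ 1 / 3 * ℕ→ℚ (2 ℕ.* m))                         ≡⟨ *-identityˡ _ ⟩
        + 1 / 3 * ℕ→ℚ (2 ℕ.* m)                                ≡⟨ ⅓-ℕ→ℚ-2* m ⟩
        + 2 / 3 * ℕ→ℚ m                                        ∎)
        where
        rearrange : ∀ u t a b → u * (t * (a * b)) ≡ (a * u) * (t * b)
        rearrange = solve 4 (λ u t a b → u :* (t :* (a :* b)) := (a :* u) :* (t :* b)) refl
      perSplit : ∀ ab → IsProperSplit S (proj₁ ab) (proj₂ ab) →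
        + 1 / 3 * ℕ→ℚ (uncurry G ab) ≤ conditional ab
      perSplit (A , B) ps@(s , 1≤A , 1≤B) =
        splitBound-≤-expect (rp f A) (rp f B) s (rp-hasLeaves f A) (rp-hasLeaves f B)
          (rp-mass f A 1≤A A≤f) (rp-mass f B 1≤B B≤f)
          (λ A∋ij → expect-lcaSize-rp-≥ f A A≤f dA (∧-conicalˡ _ _ A∋ij) (∧-conicalʳ _ _ A∋ij))
          (λ B∋ij → expect-lcaSize-rp-≥ f B B≤f dB (∧-conicalˡ _ _ B∋ij) (∧-conicalʳ _ _ B∋ij))
        where
        A≤f = ℕ.≤-pred (ℕ.<-≤-trans (properSplit-shorterˡ ps) S≤1+f)
        B≤f = ℕ.≤-pred (ℕ.<-≤-trans (properSplit-shorterʳ ps) S≤1+f)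
        dA = proj₁ (IsSplit.distinct s dS)
        dB = proj₂ (IsSplit.distinct s dS)

-- The peel-off phase and the cost on the remaining cluster

module _ {n : ℕ} where

  Unique⇒Distinct : ∀ {xs : List (Fin n)} → Unique xs → Distinct xs
  Unique⇒Distinct AllPairs.[]           = []
  Unique⇒Distinct (x≢xs AllPairs.∷ u)   = ∉ᵇ-All x≢xs ∷ Unique⇒Distinct u
    where
    ∉ᵇ-All : ∀ {x : Fin n} {ys} → All (x ≢_) ys → x ∈ᵇ ys ≡ false
    ∉ᵇ-All []                         = refl
    ∉ᵇ-All {ys = _ ∷ ys} (x≢y ∷ x≢ys) = ∉ᵇ-∷ ys x≢y (∉ᵇ-All x≢ys)

  ∈⇒∈ᵇ : ∀ {x : Fin n} {xs} → x ∈ xs → x ∈ᵇ xs ≡ true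
  ∈⇒∈ᵇ {x} {_ ∷ xs} (here refl) = ∈ᵇ-here x xs
  ∈⇒∈ᵇ {x} {y ∷ xs} (there x∈)  = ∈ᵇ-there y xs (∈⇒∈ᵇ x∈)

  members-distinct : (B : VSet n) → Distinct (members B)
  members-distinct B = Unique⇒Distinct (Unique.filter⁺ (λ v → T? (B v)) (Unique.allFin⁺ n))

  ∈ᵇ-members : (B : VSet n) (x : Fin n) → B x ≡ true → x ∈ᵇ members B ≡ true
  ∈ᵇ-members B x Bx = ∈⇒∈ᵇ (∈-filter⁺ (λ v → T? (B v)) (∈-allFin x) (subst 𝔹.T (sym Bx) _))

  filter-remove-∉ : ∀ (B : VSet n) v xs → v ∈ᵇ xs ≡ false →
    filter (λ u → T? (remove v B u)) xs ≡ filter (λ u → T? (B u)) xs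
  filter-remove-∉ B v []       _  = refl
  filter-remove-∉ B v (x ∷ xs) v∉ with x ≟ v
  ... | yes refl = ⊥-elim (true≢false (trans (sym (∈ᵇ-here v xs)) v∉))
    where true≢false : true ≢ false
          true≢false ()
  ... | no _ with B x
  ...   | true  = cong (x ∷_) (filter-remove-∉ B v xs (∨-conicalʳ ⌊ v ≟ x ⌋ (v ∈ᵇ xs) v∉))
  ...   | false = filter-remove-∉ B v xs (∨-conicalʳ ⌊ v ≟ x ⌋ (v ∈ᵇ xs) v∉)

  length-filter-remove : ∀ (B : VSet n) v xs → Distinct xs →
    length (filter (λ u → T? (B u)) xs) ℕ.≤ suc (length (filter (λ u → T? (remove v B u)) xs))
  length-filter-remove B v []       _         = ℕ.z≤n
  length-filter-remove B v (x ∷ xs) (x∉ ∷ d) with x ≟ v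
  ... | yes refl with B x
  ...   | true  = ℕ.s≤s (ℕ.≤-reflexive (cong length (sym (filter-remove-∉ B x xs x∉))))
  ...   | false = ℕ.≤-trans (ℕ.≤-reflexive (cong length (sym (filter-remove-∉ B x xs x∉)))) (ℕ.n≤1+n _)
  length-filter-remove B v (x ∷ xs) (x∉ ∷ d) | no _ with B x
  ...   | true  = ℕ.s≤s (length-filter-remove B v xs d)
  ...   | false = length-filter-remove B v xs d

  length-members-remaining : ∀ vs → n ℕ.≤ length (members (remaining {n} vs)) ℕ.+ length vs
  length-members-remaining [] = ℕ.≤-reflexive (begin
    n                                      ≡⟨ length-tabulate id ⟨
    length (allFin n)                      ≡⟨ cong length (filter-all (λ _ → T? true) {allFin n} (All.tabulate _)) ⟨
    length (members (remaining {n} []))    ≡⟨ ℕ.+-identityʳ _ ⟨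
    length (members (remaining {n} [])) ℕ.+ 0 ∎)
    where open ≡-Reasoning
  length-members-remaining (v ∷ vs) = begin
    n                                                              ≤⟨ length-members-remaining vs ⟩
    length (members (remaining vs)) ℕ.+ length vs                  ≤⟨ ℕ.+-monoˡ-≤ (length vs)
                                                                        (length-filter-remove (remaining vs) v (allFin n) allFin-distinct) ⟩
    suc (length (members (remaining (v ∷ vs)))) ℕ.+ length vs      ≡⟨ ℕ.+-suc _ (length vs) ⟨
    length (members (remaining (v ∷ vs))) ℕ.+ length (v ∷ vs)      ∎
    where
    open ℕ.≤-Reasoning
    allFin-distinct : Distinct (allFin n)
    allFin-distinct = Unique⇒Distinct (Unique.allFin⁺ n)

  mem-pmrTree : ∀ vs x t → mem {n} x t ≡ true → mem x (pmrTree vs t) ≡ true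
  mem-pmrTree []       x t x∈t = x∈t
  mem-pmrTree (v ∷ vs) x t x∈t = trans (cong (⌊ x ≟ v ⌋ ∨_) (mem-pmrTree vs x t x∈t)) (∨-zeroʳ ⌊ x ≟ v ⌋)

  lcaSize-pmrTree : ∀ vs (i j : Fin n) t → remaining vs i ≡ true → remaining vs j ≡ true →
    mem i t ≡ true → mem j t ≡ true → lcaSize (pmrTree vs t) i j ≡ lcaSize t i j
  lcaSize-pmrTree []       i j t _  _  _   _   = refl
  lcaSize-pmrTree (v ∷ vs) i j t i∈ j∈ i∈t j∈t with i ≟ v | j ≟ v
  ... | no _ | no _ rewrite mem-pmrTree vs i t i∈t | mem-pmrTree vs j t j∈t = lcaSize-pmrTree vs i j t i∈ j∈ i∈t j∈t

pairs-≢ : ∀ n → All (λ p → proj₁ p ≢ proj₂ p) (pairs n)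
pairs-≢ n = concat⁺ (map⁺ (All.tabulate {xs = allFin n} λ {i} _ →
  map⁺ (All.map (λ i<j i≡j → ℕ.<-irrefl (cong toℕ i≡j) i<j) (all-filter (λ j → toℕ i ℕ.<? toℕ j) (allFin n)))))

module _ {n : ℕ} (w : Fin n → Fin n → ℚ) where

  weightIn+redWeight : ∀ B → weightIn w B + redWeight w B ≡ totalW w
  weightIn+redWeight B = sumOf-partition (λ p → w (proj₁ p) (proj₂ p)) (λ p → B (proj₁ p) ∧ B (proj₂ p)) (pairs n)

  weightIn-nonNeg : (∀ i j → 0ℚ ≤ w i j) → ∀ B → 0ℚ ≤ weightIn w B
  weightIn-nonNeg w≥0 B = sumOf-nonNeg (λ p → w (proj₁ p) (proj₂ p)) (filter (λ p → T? (B (proj₁ p) ∧ B (proj₂ p))) (pairs n))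
                                       (λ p → w≥0 (proj₁ p) (proj₂ p))

  ALG-R-≥ : (∀ i j → 0ℚ ≤ w i j) → ∀ vs →
    + 2 / 3 * ℕ→ℚ (length (members (remaining vs))) * weightIn w (remaining vs) ≤ ALG-R w vs
  ALG-R-≥ w≥0 vs = begin
    c * sumOf weight edges                                      ≡⟨ *-sumOf c weight edges ⟩
    sumOf (λ e → c * weight e) edges                            ≤⟨ sumOf-monoᴬ (All.zipWith (λ (i≢j , e∈VB) → perEdge i≢j e∈VB)
                                                                      (filter⁺ _ (pairs-≢ n) , all-filter _ (pairs n))) ⟩
    sumOf (λ e → sumOf (λ pt → proj₁ pt * cost e (proj₂ pt)) d) edges
      ≡⟨ sumOf-swap proj₁ (λ pt e → cost e (proj₂ pt)) d edges ⟨
    ALG-R w vs                                                  ∎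
    where
    open ≤-Reasoning
    VB = remaining vs
    S = members VB
    d = rp (length S) S
    c = + 2 / 3 * ℕ→ℚ (length S)
    edges = filter (λ p → T? (VB (proj₁ p) ∧ VB (proj₂ p))) (pairs n)
    weight : Fin n × Fin n → ℚ
    weight (i , j) = w i j
    cost : Fin n × Fin n → Tree n → ℚ
    cost (i , j) t = w i j * ℕ→ℚ (lcaSize (pmrTree vs t) i j)
    perEdge : ∀ {e} → proj₁ e ≢ proj₂ e → 𝔹.T (VB (proj₁ e) ∧ VB (proj₂ e)) →
              c * weight e ≤ sumOf (λ pt → proj₁ pt * cost e (proj₂ pt)) d
    perEdge {i , j} i≢j _ with VB i in i∈VB | VB j in j∈VB
    ... | true | true = begin
      c * w i j                                                  ≡⟨ *-comm c (w i j) ⟩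
      w i j * c
        ≤⟨ *-monoˡ-≤-nonNeg (w i j) {{nonNegative (w≥0 i j)}}
             (expect-lcaSize-rp-≥ i j i≢j (length S) S ℕ.≤-refl (members-distinct VB) i∈S j∈S) ⟩
      w i j * expect (lcaSizeℚ i j) d
        ≡⟨ *-sumOf (w i j) (λ pt → proj₁ pt * lcaSizeℚ i j (proj₂ pt)) d ⟩
      sumOf (λ pt → w i j * (proj₁ pt * lcaSizeℚ i j (proj₂ pt))) d
        ≡⟨ sumOf-congᴬ (All.map (λ {pt} → pointwise {pt}) (rp-hasLeaves (length S) S)) ⟩
      sumOf (λ pt → proj₁ pt * cost (i , j) (proj₂ pt)) d        ∎
      where
      i∈S = ∈ᵇ-members VB i i∈VB
      j∈S = ∈ᵇ-members VB j j∈VB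
      pointwise : ∀ {pt} → HasLeaves (proj₂ pt) S →
        w i j * (proj₁ pt * lcaSizeℚ i j (proj₂ pt)) ≡ proj₁ pt * cost (i , j) (proj₂ pt)
      pointwise {p , t} h = trans (solve 3 (λ a b c → a :* (b :* c) := b :* (a :* c)) refl (w i j) p (lcaSizeℚ i j t))
        (cong (λ l → p * (w i j * ℕ→ℚ l))
          (sym (lcaSize-pmrTree vs i j t i∈VB j∈VB (trans (HasLeaves.mem-≡ h i) i∈S) (trans (HasLeaves.mem-≡ h j) j∈S))))

lemma3 : (n : ℕ) .{{_ : NonZero n}}
           (w : Fin n → Fin n → ℚ)
           → (∀ i j → 0ℚ ≤ w i j)
           → (∀ i j → w i j ≡ w j i)
           → (γ Rstar : ℚ)
           → 1ℚ ≤ γ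
           → 0ℚ < Rstar
           → Rstar < + 1 / 2
           → (vs : List (Fin n))
           → ValidPeel w (γ * (ℕ→ℚ 2 * totalW w) * (+ 1 / n)) (λ _ → true) vs
           → Rstar * totalW w < redWeight w (remaining vs)
           → let ℓ = ℕ→ℚ (length vs) * (+ 1 / n) in
             (+ 2 / 3) * (1ℚ - ℓ) * ℕ→ℚ n * (totalW w - redWeight w (remaining vs))
               ≤ ALG-R w vs
lemma3 (suc k) w w≥0 _ _ _ _ _ _ vs _ _ = begin
  + 2 / 3 * (1ℚ - l * (+ 1 / suc k)) * N * (totalW w - Wᵣ)
    ≡⟨ cong (λ W → + 2 / 3 * (1ℚ - l * (+ 1 / suc k)) * N * (W - Wᵣ)) (weightIn+redWeight w VB) ⟨
  + 2 / 3 * (1ℚ - l * (+ 1 / suc k)) * N * ((X + Wᵣ) - Wᵣ)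
    ≡⟨ one-minus-fraction k (+ 2 / 3) l X Wᵣ ⟩
  + 2 / 3 * (N - l) * X
    ≤⟨ *-monoʳ-≤-nonNeg X {{nonNegative (weightIn-nonNeg w w≥0 VB)}}
         (*-monoˡ-≤-nonNeg (+ 2 / 3) {{normalize-nonNeg 2 3}} (ℕ→ℚ-sub-≤ {b = length (members VB)} (length-members-remaining vs))) ⟩
  + 2 / 3 * ℕ→ℚ (length (members VB)) * X
    ≤⟨ ALG-R-≥ w w≥0 vs ⟩
  ALG-R w vs ∎
  where
  open ≤-Reasoning
  VB = remaining vs
  l = ℕ→ℚ (length vs)
  N = ℕ→ℚ (suc k)
  X = weightIn w VB
  Wᵣ = redWeight w VB
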